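{- Let $G=(V,E,w)$ be a weighted graph on $n$ vertices with $m=|E|$ edges, where $m=o(N)$. Then for any integer $0\le k\le m$ and any $a>0$, $$\Pr\big[\Delta([\mathcal{G}|E]_{n,m-k}+G)\ge a+\Delta(G)\big]\le\Pr\big[\Delta(\mathcal{G}_{n,2m})\ge a\big].$$
   Context: $N=\binom n2$; unordered vertex pairs are identified with $[N]$. $\Delta(H)$ denotes the maximum unweighted degree (maximum number of edges incident to a vertex) of a graph $H$. $\mathcal{G}_{n,k}$ is the uniformly random unweighted graph on $V$ with exactly $k$ edges. For $S\subseteq[N]$ and $0\le k\le N-|S|$, $[\mathcal{G}|S]_{n,k}$ is the random unweighted graph on $V$ whose edge set is a uniformly random $k$-subset of $[N]\setminus S$. For two graphs $G_1,G_2$ on $V$ with disjoint edge sets, $G_1+G_2$ is the graph on $V$ with the union of the edge sets. -}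

module Defs where

open import Data.Nat using (ℕ; zero; suc; _⊔_; _<ᵇ_)
open import Data.Nat.Combinatorics using (_C_)
open import Data.Bool using (Bool; true; false; not; _∧_; _∨_)
open import Data.Fin using (Fin; toℕ)
open import Data.Fin.Properties using (_≟_)
open import Data.Product using (_×_; _,_)
open import Data.List using (List; []; _∷_; _++_; map; filterᵇ; length; foldr; allFin; concatMap)
open import Relation.Nullary.Decidable using (⌊_⌋)

N : ℕ → ℕ
N n = n C 2

-- Unordered vertex pairs {i,j} of V = Fin n, represented as (i , j) with i < j.
Pair : ℕ → Set
Pair n = Fin n × Fin n

allPairs : (n : ℕ) → List (Pair n)
allPairs n = filterᵇ (λ { (i , j) → toℕ i <ᵇ toℕ j })
                     (concatMap (λ i → map (λ j → (i , j)) (allFin n)) (allFin n))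

-- An (unweighted) graph on V is given by its edge set, a list of pairs.
-- A graph G is given by the characteristic function of its edge set.
edges : {n : ℕ} → (Pair n → Bool) → List (Pair n)
edges {n} E = filterᵇ E (allPairs n)

nonEdges : {n : ℕ} → (Pair n → Bool) → List (Pair n)
nonEdges {n} E = filterᵇ (λ p → not (E p)) (allPairs n)

choose : {A : Set} → ℕ → List A → List (List A)
choose zero    _        = [] ∷ []
choose (suc k) []       = []
choose (suc k) (x ∷ xs) = map (x ∷_) (choose k xs) ++ choose (suc k) xs

deg : {n : ℕ} → List (Pair n) → Fin n → ℕ
deg L v = length (filterᵇ (λ { (i , j) → ⌊ v ≟ i ⌋ ∨ ⌊ v ≟ j ⌋ }) L)

Δ : {n : ℕ} → List (Pair n) → ℕ
Δ {n} L = foldr (λ v r → deg L v ⊔ r) 0 (allFin n)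

-- A finite uniform probability is represented as (number of favourable outcomes , number of outcomes).
record Prob : Set where
  constructor _/_
  field
    favourable : ℕ
    total      : ℕ

Pr : {A : Set} → List A → (A → Bool) → Prob
Pr Ω P = length (filterᵇ P Ω) / length Ω

-- comparison of probabilities p/q ≤ r/s by cross-multiplication (all totals here are > 0)
open Data.Nat using (_*_; _≤_)
_≤ᴾ_ : Prob → Prob → Set
(p / q) ≤ᴾ (r / s) = p * s ≤ r * q

𝒢 : (n k : ℕ) → List (List (Pair n))
𝒢 n k = choose k (allPairs n)

𝒢∣ : {n : ℕ} → (Pair n → Bool) → ℕ → List (List (Pair n))
𝒢∣ S k = choose k (nonEdges S)

-- Since Δ(T + G) ≤ Δ(T) + Δ(G), the left side is at most the density of the up-closed family
-- {T : a ≤ Δ(T)} on the (m − k)-subsets of non-edges. Splitting a uniform 2m-subset of all pairs into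
-- its i non-edges and 2m − i edges of E turns the right side into an average of the densities of the
-- same family on the i-subsets of non-edges, with weights C(N − m, i)·C(m, 2m − i). Only layers i ≥ m
-- carry weight, since E has just m pairs, and by the local LYM inequality the density does not
-- decrease with i.

module Submission where

open import Data.Bool using (Bool; true; false; not; T)
open import Data.Bool.Properties using (T?)
open import Data.List using (List; []; _∷_; [_]; _++_; length; map; filterᵇ; foldr; allFin)
open import Data.List.Properties using (length-++; length-map; filter-++; filter-all; filter-accept; filter-reject)
open import Data.List.Relation.Binary.Sublist.Propositional using (_⊆_; _∷_; _∷ʳ_; ⊆-refl)
open import Data.List.Relation.Binary.Sublist.Propositional.Properties using (filter-⊆; filter⁺; length-mono-≤)
open import Data.List.Relation.Unary.All using (All; []; _∷_; universal)
open import Data.Nat using (ℕ; zero; suc; _+_; _*_; _∸_; _⊔_; _≤_; _<_; _≤′_; _≤ᵇ_; z≤n; s≤s; ≤′-refl; ≤′-step;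
  _≟_; _≤?_; _<?_; NonZero; ≢-nonZero)
open import Data.Nat.Combinatorics using (_C_; k>n⇒nCk≡0; nC1≡n; nCk+nC[k+1]≡[n+1]C[k+1])
open import Data.Nat.Properties
open import Algebra.Properties.CommutativeSemigroup +-commutativeSemigroup using () renaming (interchange to +-interchange)
open import Data.Nat.Tactic.RingSolver using (solve-∀)
open import Data.Product using (∃; _,_)
open import Defs
open import Function using (_∘_; id)
open import Relation.Binary.PropositionalEquality using (_≡_; refl; sym; trans; cong; cong₂; subst; module ≡-Reasoning)
open import Relation.Nullary using (yes; no)

count : {A : Set} → (A → Bool) → List A → ℕ
count P xs = length (filterᵇ P xs)

UpClosed : {A : Set} → (List A → Bool) → Set
UpClosed {A} R = {X Y : List A} → X ⊆ Y → T (R X) → T (R Y)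

module _ {A : Set} where

  count-mono-⊆ : {P : A → Bool} {xs ys : List A} → xs ⊆ ys → count P xs ≤ count P ys
  count-mono-⊆ {P} xs⊆ys = length-mono-≤ (filter⁺ (T? ∘ P) (T? ∘ P) (λ { refl → id }) xs⊆ys)

  count-mono : {P Q : A → Bool} → (∀ x → T (P x) → T (Q x)) → (xs : List A) → count P xs ≤ count Q xs
  count-mono {P} {Q} P⇒Q xs = length-mono-≤ (filter⁺ (T? ∘ P) (T? ∘ Q) (λ { {x} refl → P⇒Q x }) (⊆-refl {x = xs}))

  count-++ : (P : A → Bool) (xs ys : List A) → count P (xs ++ ys) ≡ count P xs + count P ys
  count-++ P xs ys = trans (cong length (filter-++ (T? ∘ P) xs ys)) (length-++ (filterᵇ P xs))

  count-cong : {P Q : A → Bool} {xs : List A} → All (λ x → P x ≡ Q x) xs → count P xs ≡ count Q xs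
  count-cong                    []            = refl
  count-cong {P} {Q} {x ∷ xs} (Px≡Qx ∷ P≗Q) with P x | Q x | Px≡Qx
  ... | true  | .true  | refl = cong suc (count-cong P≗Q)
  ... | false | .false | refl = count-cong P≗Q

  count-true : (xs : List A) → count (λ _ → true) xs ≡ length xs
  count-true xs = cong length (filter-all (T? ∘ λ _ → true) (universal _ xs))

module _ {A B : Set} where

  count-map : (P : B → Bool) (f : A → B) (xs : List A) → count P (map f xs) ≡ count (P ∘ f) xs
  count-map P f []       = refl
  count-map P f (x ∷ xs) with P (f x)
  ... | true  = cong suc (count-map P f xs)
  ... | false = count-map P f xs

module _ {A : Set} where

  count-choose-∷ : (P : List A → Bool) (x : A) (xs : List A) (k : ℕ) →
    count P (choose (suc k) (x ∷ xs)) ≡ count (P ∘ (x ∷_)) (choose k xs) + count P (choose (suc k) xs)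
  count-choose-∷ P x xs k = begin
    count P (map (x ∷_) (choose k xs) ++ choose (suc k) xs)
      ≡⟨ count-++ P (map (x ∷_) (choose k xs)) (choose (suc k) xs) ⟩
    count P (map (x ∷_) (choose k xs)) + count P (choose (suc k) xs)
      ≡⟨ cong (_+ count P (choose (suc k) xs)) (count-map P (x ∷_) (choose k xs)) ⟩
    count (P ∘ (x ∷_)) (choose k xs) + count P (choose (suc k) xs) ∎
    where open ≡-Reasoning

  length-choose-∷ : (x : A) (xs : List A) (k : ℕ) →
    length (choose (suc k) (x ∷ xs)) ≡ length (choose k xs) + length (choose (suc k) xs)
  length-choose-∷ x xs k = trans (length-++ (map (x ∷_) (choose k xs)))
                                 (cong (_+ length (choose (suc k) xs)) (length-map (x ∷_) (choose k xs)))


  length-choose : (k : ℕ) (xs : List A) → length (choose k xs) ≡ length xs C k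
  length-choose zero    xs       = refl
  length-choose (suc k) []       = refl
  length-choose (suc k) (x ∷ xs) = begin
    length (choose (suc k) (x ∷ xs))                 ≡⟨ length-choose-∷ x xs k ⟩
    length (choose k xs) + length (choose (suc k) xs) ≡⟨ cong₂ _+_ (length-choose k xs) (length-choose (suc k) xs) ⟩
    length xs C k + length xs C suc k                 ≡⟨ nCk+nC[k+1]≡[n+1]C[k+1] (length xs) k ⟩
    suc (length xs) C suc k                           ∎
    where open ≡-Reasoning

nC[1+k]*[1+k]≡nCk*[n∸k] : ∀ n k → (n C suc k) * suc k ≡ (n C k) * (n ∸ k)
nC[1+k]*[1+k]≡nCk*[n∸k] zero    k       = sym (trans (cong ((0 C k) *_) (0∸n≡0 k)) (*-zeroʳ (0 C k)))
nC[1+k]*[1+k]≡nCk*[n∸k] (suc n) zero    = trans (*-identityʳ (suc n C 1)) (trans (nC1≡n (suc n)) (sym (+-identityʳ (suc n))))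
nC[1+k]*[1+k]≡nCk*[n∸k] (suc n) (suc k) = begin
  (suc n C suc (suc k)) * suc (suc k)
    ≡⟨ cong (_* suc (suc k)) (nCk+nC[k+1]≡[n+1]C[k+1] n (suc k)) ⟨
  (n C suc k + n C suc (suc k)) * suc (suc k)
    ≡⟨ expand (n C suc k) (n C suc (suc k)) k ⟩
  (n C suc k) * suc k + ((n C suc (suc k)) * suc (suc k) + n C suc k)
    ≡⟨ cong₂ _+_ (nC[1+k]*[1+k]≡nCk*[n∸k] n k) (cong (_+ n C suc k) (nC[1+k]*[1+k]≡nCk*[n∸k] n (suc k))) ⟩
  (n C k) * (n ∸ k) + ((n C suc k) * (n ∸ suc k) + n C suc k)
    ≡⟨ cong ((n C k) * (n ∸ k) +_) (absorb-one n k) ⟩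
  (n C k) * (n ∸ k) + (n C suc k) * (n ∸ k)
    ≡⟨ *-distribʳ-+ (n ∸ k) (n C k) (n C suc k) ⟨
  (n C k + n C suc k) * (n ∸ k)
    ≡⟨ cong (_* (n ∸ k)) (nCk+nC[k+1]≡[n+1]C[k+1] n k) ⟩
  (suc n C suc k) * (n ∸ k) ∎
  where
  open ≡-Reasoning
  expand : ∀ a b k → (a + b) * suc (suc k) ≡ a * suc k + (b * suc (suc k) + a)
  expand = solve-∀
  -- n ∸ k = 1 + (n ∸ suc k) fails only when n ≤ k, and then n C suc k = 0.
  absorb-one : ∀ n k → (n C suc k) * (n ∸ suc k) + n C suc k ≡ (n C suc k) * (n ∸ k)
  absorb-one n k with k <? n
  ... | yes k<n = trans (+-comm _ (n C suc k)) (trans (sym (*-suc (n C suc k) (n ∸ suc k))) (cong ((n C suc k) *_) (sym (+-∸-assoc 1 k<n))))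
  ... | no  k≮n rewrite k>n⇒nCk≡0 (s≤s (≮⇒≥ k≮n)) = refl

localLYM-step : ∀ {a b a′ b′ p q} k → a * p ≤ a′ * suc k → b * q ≤ b′ * suc (suc k) → b ≤ a′ → p ≤ suc q →
  (a + b) * p ≤ (a′ + b′) * suc (suc k)
localLYM-step {a} {b} {a′} {b′} {p} {q} k ap≤ bq≤ b≤a′ p≤1+q = begin
  (a + b) * p                  ≡⟨ *-distribʳ-+ p a b ⟩
  a * p + b * p                ≤⟨ +-mono-≤ ap≤ (*-monoʳ-≤ b p≤1+q) ⟩
  a′ * suc k + b * suc q       ≡⟨ regroup a′ b k q ⟩
  a′ * suc k + b + b * q       ≤⟨ +-mono-≤ (+-monoʳ-≤ (a′ * suc k) b≤a′) bq≤ ⟩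
  a′ * suc k + a′ + b′ * suc (suc k) ≡⟨ collect a′ b′ k ⟩
  (a′ + b′) * suc (suc k)      ∎
  where
  open ≤-Reasoning
  regroup : ∀ a′ b k q → a′ * suc k + b * suc q ≡ a′ * suc k + b + b * q
  regroup = solve-∀
  collect : ∀ a′ b′ k → a′ * suc k + a′ + b′ * suc (suc k) ≡ (a′ + b′) * suc (suc k)
  collect = solve-∀

module _ {A : Set} where

  count-choose-localLYM : {R : List A → Bool} → UpClosed R → (xs : List A) (k : ℕ) →
    count R (choose k xs) * (length xs ∸ k) ≤ count R (choose (suc k) xs) * suc k
  count-choose-localLYM {R} up [] zero = ≤-reflexive (*-zeroʳ (count R (choose 0 [])))
  count-choose-localLYM up [] (suc k) = z≤n
  count-choose-localLYM {R} up (x ∷ xs) zero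
    rewrite count-choose-∷ R x xs 0 | *-identityʳ (count (R ∘ (x ∷_)) (choose 0 xs) + count R (choose 1 xs)) =
    begin
      count R [ [] ] * suc (length xs)         ≡⟨ *-suc (count R [ [] ]) (length xs) ⟩
      count R [ [] ] + count R [ [] ] * length xs
        ≤⟨ +-mono-≤ (count-mono (λ X → up (x ∷ʳ ⊆-refl)) [ [] ])
                    (≤-trans (count-choose-localLYM up xs zero) (≤-reflexive (*-identityʳ _))) ⟩
      count (R ∘ (x ∷_)) [ [] ] + count R (choose 1 xs) ∎
    where open ≤-Reasoning
  count-choose-localLYM {R} up (x ∷ xs) (suc k)
    rewrite count-choose-∷ R x xs k | count-choose-∷ R x xs (suc k) =
    localLYM-step {a = count (R ∘ (x ∷_)) (choose k xs)} {b = count R (choose (suc k) xs)} k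
      (count-choose-localLYM (λ X⊆Y → up (refl ∷ X⊆Y)) xs k)
      (count-choose-localLYM up xs (suc k))
      (count-mono (λ X → up (x ∷ʳ ⊆-refl)) (choose (suc k) xs))
      (m∸n≤1+m∸[1+n] (length xs) k)
    where
    m∸n≤1+m∸[1+n] : ∀ m n → m ∸ n ≤ suc (m ∸ suc n)
    m∸n≤1+m∸[1+n] m n = ≤-trans (m≤n+m∸n (m ∸ n) 1) (≤-reflexive (cong suc (trans (∸-+-assoc m n 1) (cong (m ∸_) (+-comm n 1)))))

cross-mul-trans : ∀ a b c d e f .{{_ : NonZero d}} → a * d ≤ c * b → c * f ≤ e * d → a * f ≤ e * b
cross-mul-trans a b c d e f ad≤cb cf≤ed = *-cancelʳ-≤ (a * f) (e * b) d (begin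
  a * f * d   ≡⟨ x*y*z≡x*z*y a f d ⟩
  a * d * f   ≤⟨ *-monoˡ-≤ f ad≤cb ⟩
  c * b * f   ≡⟨ x*y*z≡x*z*y c b f ⟩
  c * f * b   ≤⟨ *-monoˡ-≤ b cf≤ed ⟩
  e * d * b   ≡⟨ x*y*z≡x*z*y e d b ⟩
  e * b * d   ∎)
  where
  open ≤-Reasoning
  x*y*z≡x*z*y : ∀ x y z → x * y * z ≡ x * z * y
  x*y*z≡x*z*y = solve-∀

module RatioMonotone (g c : ℕ → ℕ)
  (step : ∀ i → g i * c (suc i) ≤ g (suc i) * c i)
  (vanish : ∀ i → c i ≡ 0 → c (suc i) ≡ 0) where

  ratio-mono : ∀ {j i} → j ≤ i → g j * c i ≤ g i * c j
  ratio-mono = go ∘ ≤⇒≤′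
    where
    go : ∀ {j i} → j ≤′ i → g j * c i ≤ g i * c j
    go ≤′-refl = ≤-refl
    go {j} (≤′-step {i} j≤′i) with c i ≟ 0
    ... | yes cᵢ≡0 = ≤-trans (≤-reflexive (trans (cong (g j *_) (vanish i cᵢ≡0)) (*-zeroʳ (g j)))) z≤n
    ... | no  cᵢ≢0 = cross-mul-trans (g j) (c j) (g i) (c i) (g (suc i)) (c (suc i)) {{≢-nonZero cᵢ≢0}}
                       (go j≤′i) (step i)

module _ {A : Set} {R : List A → Bool} (up : UpClosed R) (xs : List A) where

  private
    g c : ℕ → ℕ
    g i = count R (choose i xs)
    c i = length (choose i xs)

    absorption : ∀ i → c (suc i) * suc i ≡ c i * (length xs ∸ i)
    absorption i = begin
      c (suc i) * suc i                ≡⟨ cong (_* suc i) (length-choose (suc i) xs) ⟩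
      (length xs C suc i) * suc i      ≡⟨ nC[1+k]*[1+k]≡nCk*[n∸k] (length xs) i ⟩
      (length xs C i) * (length xs ∸ i) ≡⟨ cong (_* (length xs ∸ i)) (length-choose i xs) ⟨
      c i * (length xs ∸ i)            ∎
      where open ≡-Reasoning

    step : ∀ i → g i * c (suc i) ≤ g (suc i) * c i
    step i = *-cancelʳ-≤ (g i * c (suc i)) (g (suc i) * c i) (suc i) (begin
      g i * c (suc i) * suc i          ≡⟨ *-assoc (g i) (c (suc i)) (suc i) ⟩
      g i * (c (suc i) * suc i)        ≡⟨ cong (g i *_) (absorption i) ⟩
      g i * (c i * (length xs ∸ i))    ≡⟨ x*[y*z]≡y*[x*z] (g i) (c i) (length xs ∸ i) ⟩
      c i * (g i * (length xs ∸ i))    ≤⟨ *-monoʳ-≤ (c i) (count-choose-localLYM up xs i) ⟩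
      c i * (g (suc i) * suc i)        ≡⟨ x*[y*z]≡y*x*z (c i) (g (suc i)) (suc i) ⟩
      g (suc i) * c i * suc i          ∎)
      where
      open ≤-Reasoning
      x*[y*z]≡y*[x*z] : ∀ x y z → x * (y * z) ≡ y * (x * z)
      x*[y*z]≡y*[x*z] = solve-∀
      x*[y*z]≡y*x*z : ∀ x y z → x * (y * z) ≡ y * x * z
      x*[y*z]≡y*x*z = solve-∀

    vanish : ∀ i → c i ≡ 0 → c (suc i) ≡ 0
    vanish i cᵢ≡0 = m*n≡0⇒m≡0 (c (suc i)) (suc i) (trans (absorption i) (cong (_* (length xs ∸ i)) cᵢ≡0))

  count-choose-density-mono : ∀ {j i} → j ≤ i →
    count R (choose j xs) * length (choose i xs) ≤ count R (choose i xs) * length (choose j xs)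
  count-choose-density-mono = RatioMonotone.ratio-mono g c step vanish

-- conv f w t = Σ_{i ≤ t} f i * w (t ∸ i)
conv : (ℕ → ℕ) → (ℕ → ℕ) → ℕ → ℕ
conv f w zero    = f 0 * w 0
conv f w (suc t) = f 0 * w (suc t) + conv (f ∘ suc) w t

shift : (ℕ → ℕ) → ℕ → ℕ
shift w zero    = 0
shift w (suc l) = w l

conv-cong : ∀ {f f′ w w′} → (∀ i → f i ≡ f′ i) → (∀ l → w l ≡ w′ l) → ∀ t → conv f w t ≡ conv f′ w′ t
conv-cong f≗f′ w≗w′ zero    = cong₂ _*_ (f≗f′ 0) (w≗w′ 0)
conv-cong f≗f′ w≗w′ (suc t) = cong₂ _+_ (cong₂ _*_ (f≗f′ 0) (w≗w′ (suc t))) (conv-cong (f≗f′ ∘ suc) w≗w′ t)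

conv-zeroˡ : ∀ w t → conv (λ _ → 0) w t ≡ 0
conv-zeroˡ w zero    = refl
conv-zeroˡ w (suc t) = conv-zeroˡ w t

conv-*ˡ : ∀ a f w t → conv (λ i → a * f i) w t ≡ a * conv f w t
conv-*ˡ a f w zero    = *-assoc a (f 0) (w 0)
conv-*ˡ a f w (suc t) = begin
  a * f 0 * w (suc t) + conv (λ i → a * f (suc i)) w t ≡⟨ cong₂ _+_ (*-assoc a (f 0) (w (suc t))) (conv-*ˡ a (f ∘ suc) w t) ⟩
  a * (f 0 * w (suc t)) + a * conv (f ∘ suc) w t      ≡⟨ *-distribˡ-+ a (f 0 * w (suc t)) (conv (f ∘ suc) w t) ⟨
  a * conv f w (suc t)                                ∎
  where open ≡-Reasoning

conv-+ˡ : ∀ f g w t → conv (λ i → f i + g i) w t ≡ conv f w t + conv g w t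
conv-+ˡ f g w zero    = *-distribʳ-+ (w 0) (f 0) (g 0)
conv-+ˡ f g w (suc t) = begin
  (f 0 + g 0) * w (suc t) + conv (λ i → f (suc i) + g (suc i)) w t
    ≡⟨ cong₂ _+_ (*-distribʳ-+ (w (suc t)) (f 0) (g 0)) (conv-+ˡ (f ∘ suc) (g ∘ suc) w t) ⟩
  (f 0 * w (suc t) + g 0 * w (suc t)) + (conv (f ∘ suc) w t + conv (g ∘ suc) w t)
    ≡⟨ +-interchange (f 0 * w (suc t)) (g 0 * w (suc t)) (conv (f ∘ suc) w t) (conv (g ∘ suc) w t) ⟩
  conv f w (suc t) + conv g w (suc t) ∎
  where open ≡-Reasoning

conv-+ʳ : ∀ f v w t → conv f (λ l → v l + w l) t ≡ conv f v t + conv f w t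
conv-+ʳ f v w zero    = *-distribˡ-+ (f 0) (v 0) (w 0)
conv-+ʳ f v w (suc t) = begin
  f 0 * (v (suc t) + w (suc t)) + conv (f ∘ suc) (λ l → v l + w l) t
    ≡⟨ cong₂ _+_ (*-distribˡ-+ (f 0) (v (suc t)) (w (suc t))) (conv-+ʳ (f ∘ suc) v w t) ⟩
  (f 0 * v (suc t) + f 0 * w (suc t)) + (conv (f ∘ suc) v t + conv (f ∘ suc) w t)
    ≡⟨ +-interchange (f 0 * v (suc t)) (f 0 * w (suc t)) (conv (f ∘ suc) v t) (conv (f ∘ suc) w t) ⟩
  conv f v (suc t) + conv f w (suc t) ∎
  where open ≡-Reasoning

conv-shiftʳ : ∀ f w t → conv f (shift w) (suc t) ≡ conv f w t
conv-shiftʳ f w zero    = trans (cong (f 0 * w 0 +_) (*-zeroʳ (f 1))) (+-identityʳ (f 0 * w 0))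
conv-shiftʳ f w (suc t) = cong (f 0 * w (suc t) +_) (conv-shiftʳ (f ∘ suc) w t)

conv-mono-≤ : ∀ {f f′} w t → (∀ i → i ≤ t → f i * w (t ∸ i) ≤ f′ i * w (t ∸ i)) → conv f w t ≤ conv f′ w t
conv-mono-≤ w zero    f≤f′ = f≤f′ 0 z≤n
conv-mono-≤ w (suc t) f≤f′ = +-mono-≤ (f≤f′ 0 z≤n) (conv-mono-≤ w t (λ i i≤t → f≤f′ (suc i) (s≤s i≤t)))

module _ {A : Set} where

  conv-choose-∷ˡ : (R : List A → Bool) (x : A) (xs : List A) (w : ℕ → ℕ) (t : ℕ) →
    conv (λ i → count (R ∘ (x ∷_)) (choose i xs)) w t + conv (λ i → count R (choose i xs)) w (suc t)
      ≡ conv (λ i → count R (choose i (x ∷ xs))) w (suc t)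
  conv-choose-∷ˡ R x xs w t = begin
    conv (shift G′) w (suc t) + conv G w (suc t)  ≡⟨ conv-+ˡ (shift G′) G w (suc t) ⟨
    conv (λ i → shift G′ i + G i) w (suc t)       ≡⟨ conv-cong pascal (λ _ → refl) (suc t) ⟩
    conv (λ i → count R (choose i (x ∷ xs))) w (suc t) ∎
    where
    open ≡-Reasoning
    G G′ : ℕ → ℕ
    G  i = count R (choose i xs)
    G′ i = count (R ∘ (x ∷_)) (choose i xs)
    pascal : ∀ i → shift G′ i + G i ≡ count R (choose i (x ∷ xs))
    pascal zero    = refl
    pascal (suc i) = sym (count-choose-∷ R x xs i)

  conv-choose-∷ʳ : (f : ℕ → ℕ) (x : A) (xs : List A) (t : ℕ) →
    conv f (λ l → length (choose l xs)) t + conv f (λ l → length (choose l xs)) (suc t)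
      ≡ conv f (λ l → length (choose l (x ∷ xs))) (suc t)
  conv-choose-∷ʳ f x xs t = begin
    conv f w t + conv f w (suc t)             ≡⟨ cong (_+ conv f w (suc t)) (conv-shiftʳ f w t) ⟨
    conv f (shift w) (suc t) + conv f w (suc t) ≡⟨ conv-+ʳ f (shift w) w (suc t) ⟨
    conv f (λ l → shift w l + w l) (suc t)    ≡⟨ conv-cong {f = f} (λ _ → refl) pascal (suc t) ⟩
    conv f (λ l → length (choose l (x ∷ xs))) (suc t) ∎
    where
    open ≡-Reasoning
    w : ℕ → ℕ
    w l = length (choose l xs)
    pascal : ∀ l → shift w l + w l ≡ length (choose l (x ∷ xs))
    pascal zero    = refl
    pascal (suc l) = sym (length-choose-∷ x xs l)

module _ {A : Set} (p : A → Bool) where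

  count-choose-split : (R : List A → Bool) (xs : List A) (t : ℕ) →
    count (R ∘ filterᵇ (not ∘ p)) (choose t xs)
      ≡ conv (λ i → count R (choose i (filterᵇ (not ∘ p) xs))) (λ l → length (choose l (filterᵇ p xs))) t
  count-choose-split R xs zero = trans (count-cong {P = R ∘ filterᵇ (not ∘ p)} {Q = R} (refl ∷ []))
                                       (sym (*-identityʳ (count R [ [] ])))
  count-choose-split R [] (suc t) = sym (cong₂ _+_ (*-zeroʳ (count R [ [] ])) (conv-zeroˡ (λ l → length (choose l [])) t))
  count-choose-split R (x ∷ xs) (suc t) with p x in px
  ... | false = begin
    count (R ∘ filterᵇ (not ∘ p)) (choose (suc t) (x ∷ xs))
      ≡⟨ count-choose-∷ (R ∘ filterᵇ (not ∘ p)) x xs t ⟩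
    count (R ∘ filterᵇ (not ∘ p) ∘ (x ∷_)) (choose t xs) + count (R ∘ filterᵇ (not ∘ p)) (choose (suc t) xs)
      ≡⟨ cong (_+ count (R ∘ filterᵇ (not ∘ p)) (choose (suc t) xs)) (count-cong (universal keep-x (choose t xs))) ⟩
    count (R ∘ (x ∷_) ∘ filterᵇ (not ∘ p)) (choose t xs) + count (R ∘ filterᵇ (not ∘ p)) (choose (suc t) xs)
      ≡⟨ cong₂ _+_ (count-choose-split (R ∘ (x ∷_)) xs t) (count-choose-split R xs (suc t)) ⟩
    conv (λ i → count (R ∘ (x ∷_)) (choose i Ne)) W t + conv (λ i → count R (choose i Ne)) W (suc t)
      ≡⟨ conv-choose-∷ˡ R x Ne W t ⟩
    conv (λ i → count R (choose i (x ∷ Ne))) W (suc t) ∎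
    where
    open ≡-Reasoning
    Ne = filterᵇ (not ∘ p) xs
    W : ℕ → ℕ
    W l = length (choose l (filterᵇ p xs))
    keep-x : ∀ X → R (filterᵇ (not ∘ p) (x ∷ X)) ≡ R (x ∷ filterᵇ (not ∘ p) X)
    keep-x X = cong R (filter-accept (T? ∘ (not ∘ p)) (subst (T ∘ not) (sym px) _))
  ... | true = begin
    count (R ∘ filterᵇ (not ∘ p)) (choose (suc t) (x ∷ xs))
      ≡⟨ count-choose-∷ (R ∘ filterᵇ (not ∘ p)) x xs t ⟩
    count (R ∘ filterᵇ (not ∘ p) ∘ (x ∷_)) (choose t xs) + count (R ∘ filterᵇ (not ∘ p)) (choose (suc t) xs)
      ≡⟨ cong (_+ count (R ∘ filterᵇ (not ∘ p)) (choose (suc t) xs)) (count-cong (universal drop-x (choose t xs))) ⟩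
    count (R ∘ filterᵇ (not ∘ p)) (choose t xs) + count (R ∘ filterᵇ (not ∘ p)) (choose (suc t) xs)
      ≡⟨ cong₂ _+_ (count-choose-split R xs t) (count-choose-split R xs (suc t)) ⟩
    conv G (λ l → length (choose l Ed)) t + conv G (λ l → length (choose l Ed)) (suc t)
      ≡⟨ conv-choose-∷ʳ G x Ed t ⟩
    conv G (λ l → length (choose l (x ∷ Ed))) (suc t) ∎
    where
    open ≡-Reasoning
    Ed = filterᵇ p xs
    G : ℕ → ℕ
    G i = count R (choose i (filterᵇ (not ∘ p) xs))
    drop-x : ∀ X → R (filterᵇ (not ∘ p) (x ∷ X)) ≡ R (filterᵇ (not ∘ p) X)
    drop-x X = cong R (filter-reject (T? ∘ (not ∘ p)) (subst (T ∘ not) px))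

  length-choose-split : (xs : List A) (t : ℕ) →
    length (choose t xs)
      ≡ conv (λ i → length (choose i (filterᵇ (not ∘ p) xs))) (λ l → length (choose l (filterᵇ p xs))) t
  length-choose-split xs t = begin
    length (choose t xs)                       ≡⟨ count-true (choose t xs) ⟨
    count (λ _ → true) (choose t xs)           ≡⟨ count-choose-split (λ _ → true) xs t ⟩
    conv (λ i → count (λ _ → true) (choose i (filterᵇ (not ∘ p) xs))) _ t
      ≡⟨ conv-cong (λ i → count-true (choose i (filterᵇ (not ∘ p) xs))) (λ _ → refl) t ⟩
    conv (λ i → length (choose i (filterᵇ (not ∘ p) xs))) _ t ∎
    where open ≡-Reasoning

  Pr-choose-mono : (xs : List A) {R : List A → Bool} → UpClosed R → (j t : ℕ) → j + length (filterᵇ p xs) ≤ t →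
    Pr (choose j (filterᵇ (not ∘ p) xs)) R ≤ᴾ Pr (choose t xs) R
  Pr-choose-mono xs {R} up j t j+e≤t = begin
    g j * length (choose t xs)          ≡⟨ cong (g j *_) (length-choose-split xs t) ⟩
    g j * conv c w t                    ≡⟨ conv-*ˡ (g j) c w t ⟨
    conv (λ i → g j * c i) w t          ≤⟨ conv-mono-≤ w t termwise ⟩
    conv (λ i → c j * g i) w t          ≡⟨ conv-*ˡ (c j) g w t ⟩
    c j * conv g w t                    ≡⟨ cong (c j *_) (count-choose-split R xs t) ⟨
    c j * count (R ∘ filterᵇ (not ∘ p)) (choose t xs)
      ≤⟨ *-monoʳ-≤ (c j) (count-mono (λ X → up (filter-⊆ (T? ∘ (not ∘ p)) X)) (choose t xs)) ⟩
    c j * count R (choose t xs)         ≡⟨ *-comm (c j) (count R (choose t xs)) ⟩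
    count R (choose t xs) * c j         ∎
    where
    open ≤-Reasoning
    Ne = filterᵇ (not ∘ p) xs
    Ed = filterᵇ p xs
    g c w : ℕ → ℕ
    g i = count R (choose i Ne)
    c i = length (choose i Ne)
    w l = length (choose l Ed)
    w-vanishes : ∀ {i} → i < j → w (t ∸ i) ≡ 0
    w-vanishes {i} i<j = trans (length-choose (t ∸ i) Ed) (k>n⇒nCk≡0 (m+n≤o⇒m≤o∸n (suc (length Ed)) (begin
      suc (length Ed) + i  ≡⟨ +-suc (length Ed) i ⟨
      length Ed + suc i    ≤⟨ +-monoʳ-≤ (length Ed) i<j ⟩
      length Ed + j        ≡⟨ +-comm (length Ed) j ⟩
      j + length Ed        ≤⟨ j+e≤t ⟩
      t                    ∎)))
    termwise : ∀ i → i ≤ t → g j * c i * w (t ∸ i) ≤ c j * g i * w (t ∸ i)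
    termwise i _ with j ≤? i
    ... | yes j≤i = *-monoˡ-≤ (w (t ∸ i))
                      (≤-trans (count-choose-density-mono up Ne j≤i) (≤-reflexive (*-comm (g i) (c j))))
    ... | no  j≰i rewrite w-vanishes (≰⇒> j≰i) | *-zeroʳ (g j * c i) = z≤n

-- ≤ᴾ is not transitive (a total may be 0), so only the event on the left is weakened.
Pr-monoˡ : {A : Set} {P Q : A → Bool} (Ω : List A) → (∀ x → T (P x) → T (Q x)) →
  (ρ : Prob) → Pr Ω Q ≤ᴾ ρ → Pr Ω P ≤ᴾ ρ
Pr-monoˡ Ω P⇒Q (r / s) Q≤ρ = ≤-trans (*-monoˡ-≤ s (count-mono P⇒Q Ω)) Q≤ρ

sup : {B : Set} → (B → ℕ) → List B → ℕ
sup f = foldr (λ v r → f v ⊔ r) 0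

module _ {B : Set} where

  sup-mono : {f g : B → ℕ} → (∀ v → f v ≤ g v) → (vs : List B) → sup f vs ≤ sup g vs
  sup-mono f≤g []       = z≤n
  sup-mono f≤g (v ∷ vs) = ⊔-mono-≤ (f≤g v) (sup-mono f≤g vs)

  sup-+ : (f g : B → ℕ) (vs : List B) → sup (λ v → f v + g v) vs ≤ sup f vs + sup g vs
  sup-+ f g []       = z≤n
  sup-+ f g (v ∷ vs) = ⊔-lub (+-mono-≤ (m≤m⊔n (f v) (sup f vs)) (m≤m⊔n (g v) (sup g vs)))
                             (≤-trans (sup-+ f g vs) (+-mono-≤ (m≤n⊔m (f v) (sup f vs)) (m≤n⊔m (g v) (sup g vs))))

module _ {n : ℕ} where

  Δ-mono-⊆ : {X Y : List (Pair n)} → X ⊆ Y → Δ X ≤ Δ Y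
  Δ-mono-⊆ X⊆Y = sup-mono (λ v → count-mono-⊆ X⊆Y) (allFin n)

  Δ-++ : (X Y : List (Pair n)) → Δ (X ++ Y) ≤ Δ X + Δ Y
  Δ-++ X Y = ≤-trans (sup-mono (λ v → ≤-reflexive (count-++ _ X Y)) (allFin n)) (sup-+ (deg X) (deg Y) (allFin n))

  Δ≥-upClosed : (a : ℕ) → UpClosed (λ X → a ≤ᵇ Δ {n} X)
  Δ≥-upClosed a {X} X⊆Y a≤ΔX = ≤⇒≤ᵇ (≤-trans (≤ᵇ⇒≤ a (Δ X) a≤ΔX) (Δ-mono-⊆ X⊆Y))

  a+ΔY≤Δ[X++Y]⇒a≤ΔX : (a : ℕ) (Y X : List (Pair n)) → T ((a + Δ Y) ≤ᵇ Δ (X ++ Y)) → T (a ≤ᵇ Δ X)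
  a+ΔY≤Δ[X++Y]⇒a≤ΔX a Y X a+ΔY≤ = ≤⇒≤ᵇ (+-cancelʳ-≤ (Δ Y) a (Δ X) (≤-trans (≤ᵇ⇒≤ (a + Δ Y) _ a+ΔY≤) (Δ-++ X Y)))

lemma4p3 : (m : ℕ → ℕ)
    → (∀ c → ∃ λ n₀ → ∀ n → n₀ ≤ n → c * m n ≤ N n)
    → ∃ λ n₀ → ∀ n → n₀ ≤ n
    → (E : Pair n → Bool) → length (edges E) ≡ m n
    → (k : ℕ) → k ≤ m n → (a : ℕ) → 0 < a
    → Pr (𝒢∣ E (m n ∸ k)) (λ T → (a + Δ (edges E)) ≤ᵇ Δ (T ++ edges E))
      ≤ᴾ Pr (𝒢 n (2 * m n)) (λ T → a ≤ᵇ Δ T)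
lemma4p3 m _ = 0 , λ n _ E |E|≡m k _ a _ →
  Pr-monoˡ (𝒢∣ E (m n ∸ k)) (a+ΔY≤Δ[X++Y]⇒a≤ΔX a (edges E)) (Pr (𝒢 n (2 * m n)) (λ T → a ≤ᵇ Δ T))
    (Pr-choose-mono E (allPairs n) (Δ≥-upClosed a) (m n ∸ k) (2 * m n) (begin
      m n ∸ k + length (edges E) ≤⟨ +-mono-≤ (m∸n≤m (m n) k) (≤-reflexive |E|≡m) ⟩
      m n + m n                  ≡⟨ cong (m n +_) (+-identityʳ (m n)) ⟨
      2 * m n                    ∎))
  where open ≤-Reasoning
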